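{- Let $c$ be a prime of the form $2^r\cdot 3+1$ ($r$ a positive integer), and let $a,b$ be integers greater than $1$ such that $a,b,c$ are pairwise relatively prime and $e_c(a)=e_c(b)=3$. Let $z,Y,Z$ be positive integers with $z\le Z$, $Y\equiv 4\pmod 6$, $a+b=c^z$ and $a+b^Y=c^Z$; write $Y=1+3N$ (so $N$ is an odd positive integer) and put $e=\nu_c(N)$. Then $e<z$ and there is a positive integer $K$ with $\gcd(K,c)=1$ such that \[b^2+b+1=Kc^{z-e},\qquad b(b-1)\,I(b)\,K=c^e(c^{Z-z}-1),\] where $I(t)=\frac{t^{3N}-1}{t^3-1}=t^{3(N-1)}+t^{3(N-2)}+\cdots+t^3+1\in\mathbb Z[t]$.
   Context: For a positive integer $M$ and an integer $A$ coprime to $M$, $e_M(A)$ is the least positive integer $e$ such that $A^e\equiv\pm1\pmod M$. $\nu_c(N)$ is the exponent of the prime $c$ in $N$. -}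

module Defs where

open import Data.Nat using (ℕ; zero; suc; _+_; _*_; _^_; _<_)
open import Data.Nat.Divisibility using (_∣_)
open import Data.Product using (_×_)
open import Data.Sum using (_⊎_)
open import Relation.Nullary using (¬_)
import Data.Integer as ℤ
import Data.Integer.Divisibility as ℤd

PlusMinusOne : ℕ → ℕ → ℕ → Set
PlusMinusOne M A e =
  (ℤ.+ M ℤd.∣ (ℤ.+ (A ^ e) ℤ.- ℤ.+ 1)) ⊎ (ℤ.+ M ℤd.∣ (ℤ.+ (A ^ e) ℤ.+ ℤ.+ 1))

IsEOrd : ℕ → ℕ → ℕ → Set
IsEOrd M A e = (0 < e) × PlusMinusOne M A e × (∀ d → 0 < d → d < e → ¬ PlusMinusOne M A d)

IsVal : ℕ → ℕ → ℕ → Set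
IsVal c N e = (c ^ e ∣ N) × ¬ (c ^ suc e ∣ N)

I : ℕ → ℕ → ℕ
I t zero = 0
I t (suc n) = t ^ (3 * n) + I t n

-- Write b = 1 + β and V = b² + b + 1, so that b³ = 1 + βV and b^Y = b + bβV·I(b).
-- Subtracting a + b = c^z from a + b^Y = c^Z gives bβV·I(b) = c^z (c^(Z-z) - 1), of c-adic
-- valuation exactly z. As e_c(b) = 3, c ∤ β and c divides b³ - 1 or b³ + 1; the latter would
-- give c ∣ b^(3N) + 1 (N is odd) besides c ∣ b^(3N) - 1, hence c ∣ 2. So c ∣ V, b³ ≡ 1 (mod c),
-- and lifting the exponent for the odd prime c gives ν_c(I(b)) = ν_c(N) = e. Therefore
-- ν_c(V) = z - e ≥ 1, and K is the part of V prime to c.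
module Submission where

open import Defs
open import Data.Nat
open import Data.Nat.Properties
open import Data.Nat.Divisibility
open import Data.Nat.DivMod
open import Data.Nat.Induction using (<-wellFounded)
open import Data.Nat.Primality
open import Data.Nat.Coprimality using (Coprime)
open import Data.Nat.Tactic.RingSolver using (solve-∀)
open import Data.Product
open import Data.Sum using (_⊎_; inj₁; inj₂; [_,_]′)
open import Induction.WellFounded using (Acc; acc)
open import Relation.Binary.PropositionalEquality
open import Relation.Binary.Definitions using (tri<; tri≈; tri>)
open import Relation.Nullary using (¬_; yes; no; contradiction)
import Data.Integer as ℤ

geometric : ℕ → ℕ → ℕ
geometric x zero    = 0
geometric x (suc n) = x ^ n + geometric x n

I≡geometric : ∀ t n → I t n ≡ geometric (t ^ 3) n
I≡geometric t zero    = refl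
I≡geometric t (suc n) = cong₂ _+_ (sym (^-*-assoc t 3 n)) (I≡geometric t n)

[1+d]^n≡1+d*geometric : ∀ d n → (1 + d) ^ n ≡ 1 + d * geometric (1 + d) n
[1+d]^n≡1+d*geometric d zero    = cong suc (sym (*-zeroʳ d))
[1+d]^n≡1+d*geometric d (suc n) = begin
  (1 + d) * (1 + d) ^ n                 ≡⟨ cong ((1 + d) *_) ih ⟩
  (1 + d) * (1 + d * g)                 ≡⟨ expand d g ⟩
  1 + d * ((1 + d * g) + g)             ≡⟨ cong (λ w → 1 + d * (w + g)) (sym ih) ⟩
  1 + d * ((1 + d) ^ n + g)             ∎
  where
  open ≡-Reasoning
  g  = geometric (1 + d) n
  ih = [1+d]^n≡1+d*geometric d n
  expand : ∀ d g → (1 + d) * (1 + d * g) ≡ 1 + d * ((1 + d * g) + g)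
  expand = solve-∀

geometric-+ : ∀ x m n → geometric x (m + n) ≡ geometric x n + x ^ n * geometric x m
geometric-+ x zero    n = sym (trans (cong (geometric x n +_) (*-zeroʳ (x ^ n))) (+-identityʳ _))
geometric-+ x (suc m) n = begin
  x ^ (m + n) + geometric x (m + n)              ≡⟨ cong₂ _+_ (^-distribˡ-+-* x m n) (geometric-+ x m n) ⟩
  x ^ m * x ^ n + (geometric x n + x ^ n * gm)   ≡⟨ rearrange (x ^ m) (x ^ n) (geometric x n) gm ⟩
  geometric x n + x ^ n * (x ^ m + gm)           ∎
  where
  open ≡-Reasoning
  gm = geometric x m
  rearrange : ∀ a b c d → a * b + (c + b * d) ≡ c + b * (a + d)
  rearrange = solve-∀

geometric-* : ∀ x m n → geometric x (m * n) ≡ geometric x m * geometric (x ^ m) n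
geometric-* x m zero    rewrite *-zeroʳ m | *-zeroʳ (geometric x m) = refl
geometric-* x m (suc n) = begin
  geometric x (m * suc n)                                ≡⟨ cong (geometric x) (*-suc m n) ⟩
  geometric x (m + m * n)                                ≡⟨ geometric-+ x m (m * n) ⟩
  geometric x (m * n) + x ^ (m * n) * gm                 ≡⟨ cong₂ (λ u v → u + v * gm) (geometric-* x m n) (sym (^-*-assoc x m n)) ⟩
  gm * geometric (x ^ m) n + (x ^ m) ^ n * gm            ≡⟨ rearrange gm (geometric (x ^ m) n) ((x ^ m) ^ n) ⟩
  gm * ((x ^ m) ^ n + geometric (x ^ m) n)               ∎
  where
  open ≡-Reasoning
  gm = geometric x m
  rearrange : ∀ a b c → a * b + c * a ≡ a * (c + b)
  rearrange = solve-∀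

triangular : ℕ → ℕ
triangular zero    = 0
triangular (suc n) = n + triangular n

triangular-odd : ∀ q → triangular (1 + 2 * q) ≡ q * (1 + 2 * q)
triangular-odd zero    = refl
triangular-odd (suc q) = begin
  triangular (1 + 2 * suc q)                        ≡⟨ cong (λ w → triangular (suc w)) (*-suc 2 q) ⟩
  2 + 2 * q + (1 + 2 * q + triangular (1 + 2 * q))  ≡⟨ cong (λ w → 2 + 2 * q + (1 + 2 * q + w)) (triangular-odd q) ⟩
  2 + 2 * q + (1 + 2 * q + q * (1 + 2 * q))         ≡⟨ rearrange q ⟩
  suc q * (1 + 2 * suc q)                           ∎
  where
  open ≡-Reasoning
  rearrange : ∀ q → 2 + 2 * q + (1 + 2 * q + q * (1 + 2 * q)) ≡ (1 + q) * (1 + 2 * (1 + q))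
  rearrange = solve-∀

[1+tp]^n≡1+sp : ∀ t p n → ∃ λ s → (1 + t * p) ^ n ≡ 1 + s * p
[1+tp]^n≡1+sp t p n = t * geometric (1 + t * p) n ,
  trans ([1+d]^n≡1+d*geometric (t * p) n) (cong (1 +_) (rearrange t p _))
  where
  rearrange : ∀ t p g → t * p * g ≡ t * g * p
  rearrange = solve-∀

[1+tp]^n≡1+ntp+sp² : ∀ t p n → ∃ λ s → (1 + t * p) ^ n ≡ 1 + n * t * p + s * (p * p)
[1+tp]^n≡1+ntp+sp² t p zero    = 0 , refl
[1+tp]^n≡1+ntp+sp² t p (suc n) =
  let s , eq = [1+tp]^n≡1+ntp+sp² t p n
  in s + n * t * t + t * s * p , trans (cong ((1 + t * p) *_) eq) (expand t p n s)
  where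
  expand : ∀ t p n s → (1 + t * p) * (1 + n * t * p + s * (p * p))
           ≡ 1 + (1 + n) * t * p + (s + n * t * t + t * s * p) * (p * p)
  expand = solve-∀

geometric[1+tp]≡n+tpT+sp² : ∀ t p n → ∃ λ s →
  geometric (1 + t * p) n ≡ n + t * p * triangular n + s * (p * p)
geometric[1+tp]≡n+tpT+sp² t p zero    = 0 , sym (trans (+-identityʳ _) (*-zeroʳ (t * p)))
geometric[1+tp]≡n+tpT+sp² t p (suc n) =
  let s₁ , eq₁ = [1+tp]^n≡1+ntp+sp² t p n
      s₂ , eq₂ = geometric[1+tp]≡n+tpT+sp² t p n
  in s₁ + s₂ , trans (cong₂ _+_ eq₁ eq₂) (rearrange n s₁ s₂ p t (triangular n))
  where
  rearrange : ∀ n a b p t u → 1 + n * t * p + a * (p * p) + (n + t * p * u + b * (p * p))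
              ≡ suc n + t * p * (n + u) + (a + b) * (p * p)
  rearrange = solve-∀

geometric[1+tp]≡n+sp : ∀ t p n → ∃ λ s → geometric (1 + t * p) n ≡ n + s * p
geometric[1+tp]≡n+sp t p n =
  let s , eq = geometric[1+tp]≡n+tpT+sp² t p n
  in t * triangular n + s * p , trans eq (rearrange n t p (triangular n) s)
  where
  rearrange : ∀ n t p u s → n + t * p * u + s * (p * p) ≡ n + (t * u + s * p) * p
  rearrange = solve-∀

-- For odd p the second-order term t p (p choose 2) is divisible by p², which fails for p = 2.
geometric[1+tp]p≡p[1+wp] : ∀ t q → let p = 1 + 2 * q in
  ∃ λ w → geometric (1 + t * p) p ≡ p * (1 + w * p)
geometric[1+tp]p≡p[1+wp] t q =
  let s , eq = geometric[1+tp]≡n+tpT+sp² t p p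
  in t * q + s , (begin
    geometric (1 + t * p) p                 ≡⟨ eq ⟩
    p + t * p * triangular p + s * (p * p)  ≡⟨ cong (λ w → p + t * p * w + s * (p * p)) (triangular-odd q) ⟩
    p + t * p * (q * p) + s * (p * p)       ≡⟨ rearrange t q s p ⟩
    p * (1 + (t * q + s) * p)               ∎)
  where
  open ≡-Reasoning
  p = 1 + 2 * q
  rearrange : ∀ t q s p → p + t * p * (q * p) + s * (p * p) ≡ p * (1 + (t * q + s) * p)
  rearrange = solve-∀

geometric-*-[1+tp] : ∀ t p m n → ∃ λ s →
  geometric (1 + t * p) (m * n) ≡ geometric (1 + t * p) m * geometric (1 + s * p) n
geometric-*-[1+tp] t p m n =
  let s , eq = [1+tp]^n≡1+sp t p m
  in s , trans (geometric-* (1 + t * p) m n) (cong (λ x → geometric (1 + t * p) m * geometric x n) eq)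

prime⇒>1 : ∀ {p} → Prime p → 1 < p
prime⇒>1 {p} p-prime = nonTrivial⇒n>1 p {{prime⇒nonTrivial p-prime}}

prime⇒∤1 : ∀ {p} → Prime p → ¬ p ∣ 1
prime⇒∤1 p-prime p∣1 = <⇒≢ (prime⇒>1 p-prime) (sym (∣1⇒≡1 p∣1))

p^m∣p^n : ∀ p {m n} → m ≤ n → p ^ m ∣ p ^ n
p^m∣p^n p {m} {n} m≤n = divides (p ^ (n ∸ m)) (begin
  p ^ n                ≡⟨ cong (p ^_) (sym (m+[n∸m]≡n m≤n)) ⟩
  p ^ (m + (n ∸ m))    ≡⟨ ^-distribˡ-+-* p m (n ∸ m) ⟩
  p ^ m * p ^ (n ∸ m)  ≡⟨ *-comm (p ^ m) _ ⟩
  p ^ (n ∸ m) * p ^ m  ∎)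
  where open ≡-Reasoning

¬∣⇒¬∣+* : ∀ {p m} s → ¬ p ∣ m → ¬ p ∣ m + s * p
¬∣⇒¬∣+* {p} {m} s p∤m p∣m+sp = p∤m (∣m+n∣m⇒∣n (subst (p ∣_) (+-comm m (s * p)) p∣m+sp) (n∣m*n s))

¬∣p^k∸1 : ∀ {p} k → 1 < p → 0 < k → ¬ p ∣ p ^ k ∸ 1
¬∣p^k∸1 {p} (suc k) p>1 _ p∣p^k∸1 = <⇒≢ p>1 (sym (∣1⇒≡1 (∣m+n∣m⇒∣n p∣p^k∸1+1 p∣p^k∸1)))
  where
  instance _ = >-nonZero (<-trans z<s p>1)
  p∣p^k∸1+1 : p ∣ p ^ suc k ∸ 1 + 1
  p∣p^k∸1+1 = subst (p ∣_) (sym (m∸n+n≡m (m^n>0 p (suc k)))) (m∣m*n (p ^ k))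

¬∣⇒coprime : ∀ {p n} → Prime p → ¬ p ∣ n → Coprime n p
¬∣⇒coprime p-prime p∤n (d∣n , d∣p) with prime⇒irreducible p-prime d∣p
... | inj₁ d≡1 = d≡1
... | inj₂ refl = contradiction d∣n p∤n

¬∣⇒>0 : ∀ {p n} → ¬ p ∣ n → 0 < n
¬∣⇒>0 {p} {zero}  p∤0 = contradiction (p ∣0) p∤0
¬∣⇒>0 {p} {suc n} _   = z<s

isVal⇒≢0 : ∀ {p n e} → IsVal p n e → n ≢ 0
isVal⇒≢0 {p} {e = e} (_ , p^1+e∤n) refl = p^1+e∤n ((p ^ suc e) ∣0)

isVal-0 : ∀ {p n} → ¬ p ∣ n → IsVal p n 0
isVal-0 {p} {n} p∤n = 1∣ n , λ p*1∣n → p∤n (subst (_∣ n) (*-identityʳ p) p*1∣n)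

isVal-p^e*m : ∀ {p m} e .{{_ : NonZero p}} → ¬ p ∣ m → IsVal p (p ^ e * m) e
isVal-p^e*m {p} {m} e p∤m = m∣m*n m , λ p^1+e∣p^e*m →
  p∤m (*-cancelˡ-∣ (p ^ e) {{m^n≢0 p e}} (subst (_∣ p ^ e * m) (*-comm p (p ^ e)) p^1+e∣p^e*m))

isVal-p*m : ∀ {p m} .{{_ : NonZero p}} → ¬ p ∣ m → IsVal p (p * m) 1
isVal-p*m {p} {m} p∤m = subst (λ n → IsVal p n 1) (cong (_* m) (*-identityʳ p)) (isVal-p^e*m 1 p∤m)

isVal⇒p^e*m : ∀ {p n e} → IsVal p n e → ∃ λ m → n ≡ p ^ e * m × ¬ p ∣ m
isVal⇒p^e*m {p} {n} {e} (divides m n≡m*p^e , p^1+e∤n) = m , trans n≡m*p^e (*-comm m (p ^ e)) , p∤m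
  where
  open ≡-Reasoning
  p∤m : ¬ p ∣ m
  p∤m (divides k m≡k*p) = p^1+e∤n (divides k (begin
    n                ≡⟨ n≡m*p^e ⟩
    m * p ^ e        ≡⟨ cong (_* p ^ e) m≡k*p ⟩
    k * p * p ^ e    ≡⟨ *-assoc k p (p ^ e) ⟩
    k * p ^ suc e    ∎))

isVal-* : ∀ {p m n e f} → Prime p → IsVal p m e → IsVal p n f → IsVal p (m * n) (e + f)
isVal-* {p} {m} {n} {e} {f} p-prime νm νn =
  subst (λ k → IsVal p k (e + f)) (sym m*n≡) (isVal-p^e*m (e + f) {{prime⇒nonZero p-prime}} p∤m′n′)
  where
  open ≡-Reasoning
  m-split = isVal⇒p^e*m {e = e} νm
  n-split = isVal⇒p^e*m {e = f} νn
  m′ = proj₁ m-split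
  n′ = proj₁ n-split
  p∤m′n′ : ¬ p ∣ m′ * n′
  p∤m′n′ p∣m′n′ = [ proj₂ (proj₂ m-split) , proj₂ (proj₂ n-split) ]′ (euclidsLemma m′ n′ p-prime p∣m′n′)
  rearrange : ∀ a b c d → a * c * (b * d) ≡ a * b * (c * d)
  rearrange = solve-∀
  m*n≡ : m * n ≡ p ^ (e + f) * (m′ * n′)
  m*n≡ = begin
    m * n                          ≡⟨ cong₂ _*_ (proj₁ (proj₂ m-split)) (proj₁ (proj₂ n-split)) ⟩
    p ^ e * m′ * (p ^ f * n′)      ≡⟨ rearrange (p ^ e) (p ^ f) m′ n′ ⟩
    p ^ e * p ^ f * (m′ * n′)      ≡⟨ cong (_* (m′ * n′)) (sym (^-distribˡ-+-* p e f)) ⟩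
    p ^ (e + f) * (m′ * n′)        ∎

isVal-unique : ∀ {p n e f} → IsVal p n e → IsVal p n f → e ≡ f
isVal-unique {p} {e = e} {f} (p^e∣n , p^1+e∤n) (p^f∣n , p^1+f∤n) with <-cmp e f
... | tri< e<f _ _ = contradiction (∣-trans (p^m∣p^n p e<f) p^f∣n) p^1+e∤n
... | tri≈ _ e≡f _ = e≡f
... | tri> _ _ f<e = contradiction (∣-trans (p^m∣p^n p f<e) p^e∣n) p^1+f∤n

isVal-exists : ∀ {p n} → Prime p → 0 < n → ∃ (IsVal p n)
isVal-exists {p} {n} p-prime = go n (<-wellFounded n)
  where
  instance _ = prime⇒nonZero p-prime
  νp : IsVal p (p * 1) 1
  νp = isVal-p*m (prime⇒∤1 p-prime)
  go : ∀ n → Acc _<_ n → 0 < n → ∃ (IsVal p n)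
  go n (acc rec) n>0 with p ∣? n
  ... | no p∤n = 0 , isVal-0 p∤n
  ... | yes (divides zero n≡0) = contradiction n≡0 (≢-nonZero⁻¹ n {{>-nonZero n>0}})
  ... | yes (divides (suc m) n≡m*p) =
    let m<n = subst (suc m <_) (sym n≡m*p) (m<m*n (suc m) p (prime⇒>1 p-prime))
        v , νm = go (suc m) (rec m<n) z<s
    in suc v , subst (λ k → IsVal p k (suc v)) p*1*m≡n (isVal-* {e = 1} {v} p-prime νp νm)
    where
    p*1*m≡n : p * 1 * suc m ≡ n
    p*1*m≡n = trans (cong (_* suc m) (*-identityʳ p)) (trans (*-comm p (suc m)) (sym n≡m*p))

module _ {q : ℕ} (p-prime : Prime (1 + 2 * q)) where
  private
    p = 1 + 2 * q

  isVal-geometric-p^e : ∀ t e → IsVal p (geometric (1 + t * p) (p ^ e)) e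
  isVal-geometric-p^e t zero    = isVal-0 (prime⇒∤1 p-prime)
  isVal-geometric-p^e t (suc e) =
    subst (λ n → IsVal p n (suc e)) split (isVal-* {e = 1} {e} p-prime (isVal-p*m p∤1+wp) (isVal-geometric-p^e t e))
    where
    open ≡-Reasoning
    x = 1 + t * p
    s = proj₁ (geometric-*-[1+tp] t p (p ^ e) p)
    w = proj₁ (geometric[1+tp]p≡p[1+wp] s q)
    p∤1+wp : ¬ p ∣ 1 + w * p
    p∤1+wp = ¬∣⇒¬∣+* w (prime⇒∤1 p-prime)
    split : p * (1 + w * p) * geometric x (p ^ e) ≡ geometric x (p ^ suc e)
    split = begin
      p * (1 + w * p) * geometric x (p ^ e)              ≡⟨ *-comm (p * (1 + w * p)) _ ⟩
      geometric x (p ^ e) * (p * (1 + w * p))            ≡⟨ cong (geometric x (p ^ e) *_) (sym (proj₂ (geometric[1+tp]p≡p[1+wp] s q))) ⟩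
      geometric x (p ^ e) * geometric (1 + s * p) p      ≡⟨ sym (proj₂ (geometric-*-[1+tp] t p (p ^ e) p)) ⟩
      geometric x (p ^ e * p)                            ≡⟨ cong (geometric x) (*-comm (p ^ e) p) ⟩
      geometric x (p ^ suc e)                            ∎

  isVal-geometric : ∀ t {N e} → IsVal p N e → IsVal p (geometric (1 + t * p) N) e
  isVal-geometric t {N} {e} νN =
    subst (λ n → IsVal p n e) split (isVal-* {e = 0} {e} p-prime (isVal-0 p∤m+s′p) (isVal-geometric-p^e t e))
    where
    open ≡-Reasoning
    x = 1 + t * p
    N-split = isVal⇒p^e*m {e = e} νN
    m = proj₁ N-split
    s = proj₁ (geometric-*-[1+tp] t p (p ^ e) m)
    s′ = proj₁ (geometric[1+tp]≡n+sp s p m)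
    p∤m+s′p : ¬ p ∣ m + s′ * p
    p∤m+s′p = ¬∣⇒¬∣+* s′ (proj₂ (proj₂ N-split))
    split : (m + s′ * p) * geometric x (p ^ e) ≡ geometric x N
    split = begin
      (m + s′ * p) * geometric x (p ^ e)             ≡⟨ *-comm (m + s′ * p) _ ⟩
      geometric x (p ^ e) * (m + s′ * p)             ≡⟨ cong (geometric x (p ^ e) *_) (sym (proj₂ (geometric[1+tp]≡n+sp s p m))) ⟩
      geometric x (p ^ e) * geometric (1 + s * p) m  ≡⟨ sym (proj₂ (geometric-*-[1+tp] t p (p ^ e) m)) ⟩
      geometric x (p ^ e * m)                        ≡⟨ cong (geometric x) (sym (proj₁ (proj₂ N-split))) ⟩
      geometric x N                                  ∎

isVal-product : ∀ {p m y x v e z k} → Prime p → ¬ p ∣ m → IsVal p y v → IsVal p x e →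
  m * y * x ≡ p ^ z * (p ^ k ∸ 1) → v + e ≡ z
isVal-product {p} {m} {y} {x} {v} {e} {z} {k} p-prime p∤m νy νx eq =
  isVal-unique {e = v + e} {f = z} νmyx
    (subst (λ n → IsVal p n z) (sym eq) (isVal-p^e*m z {{prime⇒nonZero p-prime}} p∤p^k∸1))
  where
  νmyx : IsVal p (m * y * x) (v + e)
  νmyx = isVal-* {e = v} {f = e} p-prime (isVal-* {e = 0} {f = v} p-prime (isVal-0 p∤m) νy) νx
  k>0 : 0 < k
  k>0 = n≢0⇒n>0 λ { refl → isVal⇒≢0 {e = v + e} νmyx (trans eq (*-zeroʳ (p ^ z))) }
  p∤p^k∸1 : ¬ p ∣ p ^ k ∸ 1
  p∤p^k∸1 = ¬∣p^k∸1 k (prime⇒>1 p-prime) k>0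

split-cofactor : ∀ {p m y x e z k} → Prime p → 0 < y → p ∣ y → ¬ p ∣ m → IsVal p x e →
  m * y * x ≡ p ^ z * (p ^ k ∸ 1) →
  e < z × ∃ λ K → ¬ p ∣ K × y ≡ K * p ^ (z ∸ e) × m * x * K ≡ p ^ e * (p ^ k ∸ 1)
split-cofactor {p} {m} {y} {x} {e} {z} {k} p-prime y>0 p∣y p∤m νx eq =
  e<z , K , p∤K , y≡K*p^[z∸e] , cancel
  where
  open ≡-Reasoning
  instance _ = prime⇒nonZero p-prime
  v = proj₁ (isVal-exists p-prime y>0)
  νy = proj₂ (isVal-exists p-prime y>0)
  K = proj₁ (isVal⇒p^e*m {e = v} νy)
  y≡p^v*K = proj₁ (proj₂ (isVal⇒p^e*m {e = v} νy))
  p∤K = proj₂ (proj₂ (isVal⇒p^e*m {e = v} νy))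
  v+e≡z : v + e ≡ z
  v+e≡z = isVal-product {v = v} {e = e} {k = k} p-prime p∤m νy νx eq
  v>0 : 0 < v
  v>0 = n≢0⇒n>0 λ v≡0 → proj₂ (subst (IsVal p y) v≡0 νy) (subst (_∣ y) (sym (*-identityʳ p)) p∣y)
  e<z : e < z
  e<z = subst (e <_) v+e≡z (m<n+m e v>0)
  y≡K*p^[z∸e] : y ≡ K * p ^ (z ∸ e)
  y≡K*p^[z∸e] = trans y≡p^v*K (trans (*-comm (p ^ v) K)
                  (cong (λ w → K * p ^ w) (sym (trans (cong (_∸ e) (sym v+e≡z)) (m+n∸n≡m v e)))))
  rearrange : ∀ a m x k → a * (m * x * k) ≡ m * (a * k) * x
  rearrange = solve-∀
  cancel : m * x * K ≡ p ^ e * (p ^ k ∸ 1)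
  cancel = *-cancelˡ-≡ _ _ (p ^ v) {{m^n≢0 p v}} (begin
    p ^ v * (m * x * K)          ≡⟨ rearrange (p ^ v) m x K ⟩
    m * (p ^ v * K) * x          ≡⟨ cong (λ w → m * w * x) (sym y≡p^v*K) ⟩
    m * y * x                    ≡⟨ eq ⟩
    p ^ z * (p ^ k ∸ 1)          ≡⟨ cong (λ w → p ^ w * (p ^ k ∸ 1)) (sym v+e≡z) ⟩
    p ^ (v + e) * (p ^ k ∸ 1)    ≡⟨ cong (_* (p ^ k ∸ 1)) (^-distribˡ-+-* p v e) ⟩
    p ^ v * p ^ e * (p ^ k ∸ 1)  ≡⟨ *-assoc (p ^ v) (p ^ e) _ ⟩
    p ^ v * (p ^ e * (p ^ k ∸ 1)) ∎)

x+1∣x^[1+2k]+1 : ∀ x k → x + 1 ∣ x ^ (1 + 2 * k) + 1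
x+1∣x^[1+2k]+1 zero    k       = 1∣ _
x+1∣x^[1+2k]+1 (suc χ) zero    = ∣-reflexive (cong (_+ 1) (sym (*-identityʳ (suc χ))))
x+1∣x^[1+2k]+1 (suc χ) (suc k) =
  ∣m+n∣m⇒∣n (subst (suc χ + 1 ∣_) step (∣n⇒∣m*n (suc χ * suc χ) (x+1∣x^[1+2k]+1 (suc χ) k))) (n∣m*n χ)
  where
  open ≡-Reasoning
  x = suc χ
  y = x ^ (2 * k)
  expand : ∀ χ y → (1 + χ) * (1 + χ) * ((1 + χ) * y + 1) ≡ χ * ((1 + χ) + 1) + ((1 + χ) * ((1 + χ) * ((1 + χ) * y)) + 1)
  expand = solve-∀
  step : x * x * (x ^ (1 + 2 * k) + 1) ≡ χ * (x + 1) + (x ^ (1 + 2 * suc k) + 1)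
  step = begin
    x * x * (x * y + 1)                        ≡⟨ expand χ y ⟩
    χ * (x + 1) + (x * (x * (x * y)) + 1)      ≡⟨ cong (λ n → χ * (x + 1) + (x ^ (1 + n) + 1)) (sym (*-suc 2 k)) ⟩
    χ * (x + 1) + (x ^ (1 + 2 * suc k) + 1)    ∎

cube : ∀ β → suc β ^ 3 ≡ 1 + β * (suc β ^ 2 + suc β + 1)
cube = expand
  where
  expand : ∀ β → (1 + β) * ((1 + β) * ((1 + β) * 1)) ≡ 1 + β * ((1 + β) * ((1 + β) * 1) + (1 + β) + 1)
  expand = solve-∀

[1+β]^3n≡1+βVI : ∀ β n → suc β ^ (3 * n) ≡ 1 + β * (suc β ^ 2 + suc β + 1) * I (suc β) n
[1+β]^3n≡1+βVI β n = begin
  suc β ^ (3 * n)                      ≡⟨ sym (^-*-assoc (suc β) 3 n) ⟩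
  (suc β ^ 3) ^ n                      ≡⟨ cong (_^ n) (cube β) ⟩
  (1 + βV) ^ n                         ≡⟨ [1+d]^n≡1+d*geometric βV n ⟩
  1 + βV * geometric (1 + βV) n        ≡⟨ cong (λ x → 1 + βV * geometric x n) (sym (cube β)) ⟩
  1 + βV * geometric (suc β ^ 3) n     ≡⟨ cong (λ i → 1 + βV * i) (sym (I≡geometric (suc β) n)) ⟩
  1 + βV * I (suc β) n                 ∎
  where
  open ≡-Reasoning
  βV = β * (suc β ^ 2 + suc β + 1)

∣⇒plusMinusOne : ∀ {M A k n} → A ^ k ≡ suc n → M ∣ n → PlusMinusOne M A k
∣⇒plusMinusOne {M} A^k≡1+n M∣n = inj₁ (subst (λ a → M ∣ ℤ.∣ ℤ.+ a ℤ.- ℤ.+ 1 ∣) (sym A^k≡1+n) M∣n)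

plusMinusOne⇒∣⊎∣ : ∀ {M A k n} → A ^ k ≡ suc n → PlusMinusOne M A k → M ∣ n ⊎ M ∣ A ^ k + 1
plusMinusOne⇒∣⊎∣ {M} A^k≡1+n (inj₁ M∣A^k-1) = inj₁ (subst (λ a → M ∣ ℤ.∣ ℤ.+ a ℤ.- ℤ.+ 1 ∣) A^k≡1+n M∣A^k-1)
plusMinusOne⇒∣⊎∣ A^k≡1+n (inj₂ M∣A^k+1) = inj₂ M∣A^k+1

isEOrd>1⇒∤pred : ∀ {c β k} → IsEOrd c (suc β) k → 1 < k → ¬ c ∣ β
isEOrd>1⇒∤pred {β = β} (_ , _ , minimal) k>1 c∣β =
  minimal 1 z<s k>1 (∣⇒plusMinusOne {A = suc β} {k = 1} (*-identityʳ (suc β)) c∣β)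

[1+β]^[1+3n]≡[1+β]+[1+β]βVI : ∀ β n →
  suc β ^ (1 + 3 * n) ≡ suc β + suc β * β * (suc β ^ 2 + suc β + 1) * I (suc β) n
[1+β]^[1+3n]≡[1+β]+[1+β]βVI β n = begin
  suc β * suc β ^ (3 * n)                 ≡⟨ cong (suc β *_) ([1+β]^3n≡1+βVI β n) ⟩
  suc β * (1 + β * V * I (suc β) n)       ≡⟨ rearrange (suc β) β V (I (suc β) n) ⟩
  suc β + suc β * β * V * I (suc β) n     ∎
  where
  open ≡-Reasoning
  V = suc β ^ 2 + suc β + 1
  rearrange : ∀ b β v i → b * (1 + β * v * i) ≡ b + b * β * v * i
  rearrange = solve-∀

isEOrd≡3⇒∣b²+b+1 : ∀ {c β k} → Prime c → 2 < c → IsEOrd c (suc β) 3 → ¬ c ∣ suc β →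
  c ∣ suc β * β * (suc β ^ 2 + suc β + 1) * I (suc β) (1 + 2 * k) → c ∣ suc β ^ 2 + suc β + 1
isEOrd≡3⇒∣b²+b+1 {c} {β} {k} c-prime c>2 eo@(_ , ±1 , _) c∤b c∣bβVI
  with plusMinusOne⇒∣⊎∣ {A = suc β} {k = 3} (cube β) ±1
... | inj₁ c∣βV = [ (λ c∣β → contradiction c∣β c∤β) , (λ c∣V → c∣V) ]′ (euclidsLemma β V c-prime c∣βV)
  where
  V = suc β ^ 2 + suc β + 1
  c∤β = isEOrd>1⇒∤pred eo (s≤s (s≤s z≤n))
... | inj₂ c∣b³+1 = contradiction (∣⇒≤ (∣m+n∣m⇒∣n c∣βVI+2 c∣βVI)) (<⇒≱ c>2)
  where
  N = 1 + 2 * k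
  βVI = β * (suc β ^ 2 + suc β + 1) * I (suc β) N
  reassoc : ∀ b β v i → b * β * v * i ≡ b * (β * v * i)
  reassoc = solve-∀
  c∣βVI : c ∣ βVI
  c∣βVI with euclidsLemma (suc β) βVI c-prime (subst (c ∣_) (reassoc (suc β) β _ (I (suc β) N)) c∣bβVI)
  ... | inj₁ c∣b   = contradiction c∣b c∤b
  ... | inj₂ c∣βVI = c∣βVI
  b^3N+1≡βVI+2 : suc β ^ (3 * N) + 1 ≡ βVI + 2
  b^3N+1≡βVI+2 = trans (cong (_+ 1) ([1+β]^3n≡1+βVI β N)) (trans (+-comm (1 + βVI) 1) (+-comm 2 βVI))
  c∣βVI+2 : c ∣ βVI + 2
  c∣βVI+2 = subst (c ∣_) (trans (cong (_+ 1) (^-*-assoc (suc β) 3 N)) b^3N+1≡βVI+2)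
              (∣-trans {j = suc β ^ 3 + 1} c∣b³+1 (x+1∣x^[1+2k]+1 (suc β ^ 3) k))

isVal-I : ∀ {c q β N e} → Prime c → c ≡ 1 + 2 * q → c ∣ suc β ^ 2 + suc β + 1 →
  IsVal c N e → IsVal c (I (suc β) N) e
isVal-I {q = q} {β} {N} {e} c-prime refl (divides u V≡u*c) νN =
  subst (λ n → IsVal (1 + 2 * q) n e) geometric≡I (isVal-geometric {q} c-prime (β * u) {N} {e} νN)
  where
  geometric≡I : geometric (1 + β * u * (1 + 2 * q)) N ≡ I (suc β) N
  geometric≡I = trans (cong (λ x → geometric (1 + x) N) (trans (*-assoc β u _) (cong (β *_) (sym V≡u*c))))
                  (trans (cong (λ x → geometric x N) (sym (cube β))) (sym (I≡geometric (suc β) N)))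

[1+3n]%6≡4⇒odd : ∀ n → (1 + 3 * n) % 6 ≡ 4 → ∃ λ k → n ≡ 1 + 2 * k
[1+3n]%6≡4⇒odd zero          ()
[1+3n]%6≡4⇒odd (suc zero)    _ = 0 , refl
[1+3n]%6≡4⇒odd (suc (suc n)) [1+3[2+n]]%6≡4 =
  let k , n≡1+2k = [1+3n]%6≡4⇒odd n [1+3n]%6≡4
  in suc k , trans (cong (2 +_) n≡1+2k) (shift k)
  where
  shift : ∀ k → 2 + (1 + 2 * k) ≡ 1 + 2 * (1 + k)
  shift = solve-∀
  unshift : ∀ n → 1 + 3 * (2 + n) ≡ 1 + 3 * n + 1 * 6
  unshift = solve-∀
  [1+3n]%6≡4 : (1 + 3 * n) % 6 ≡ 4
  [1+3n]%6≡4 = trans (sym ([m+kn]%n≡m%n (1 + 3 * n) 1 6)) (trans (cong (_% 6) (sym (unshift n))) [1+3[2+n]]%6≡4)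

x≡c^z*[c^[Z∸z]∸1] : ∀ {a b x c z Z} → z ≤ Z → a + b ≡ c ^ z → a + (b + x) ≡ c ^ Z →
  x ≡ c ^ z * (c ^ (Z ∸ z) ∸ 1)
x≡c^z*[c^[Z∸z]∸1] {a} {b} {x} {c} {z} {Z} z≤Z a+b≡c^z a+[b+x]≡c^Z = begin
  x                                  ≡⟨ sym (m+n∸m≡n (c ^ z) x) ⟩
  c ^ z + x ∸ c ^ z                  ≡⟨ cong (_∸ c ^ z) c^z+x≡c^z*c^[Z∸z] ⟩
  c ^ z * c ^ (Z ∸ z) ∸ c ^ z        ≡⟨ cong (c ^ z * c ^ (Z ∸ z) ∸_) (sym (*-identityʳ (c ^ z))) ⟩
  c ^ z * c ^ (Z ∸ z) ∸ c ^ z * 1    ≡⟨ sym (*-distribˡ-∸ (c ^ z) (c ^ (Z ∸ z)) 1) ⟩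
  c ^ z * (c ^ (Z ∸ z) ∸ 1)          ∎
  where
  open ≡-Reasoning
  c^z+x≡c^z*c^[Z∸z] : c ^ z + x ≡ c ^ z * c ^ (Z ∸ z)
  c^z+x≡c^z*c^[Z∸z] = begin
    c ^ z + x              ≡⟨ cong (_+ x) (sym a+b≡c^z) ⟩
    a + b + x              ≡⟨ +-assoc a b x ⟩
    a + (b + x)            ≡⟨ a+[b+x]≡c^Z ⟩
    c ^ Z                  ≡⟨ cong (c ^_) (sym (m+[n∸m]≡n z≤Z)) ⟩
    c ^ (z + (Z ∸ z))      ≡⟨ ^-distribˡ-+-* c z (Z ∸ z) ⟩
    c ^ z * c ^ (Z ∸ z)    ∎

odd-prime>2 : ∀ {p q} → Prime p → p ≡ 1 + 2 * q → 2 < p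
odd-prime>2 {q = zero}  p-prime refl = contradiction (prime⇒>1 p-prime) (<-irrefl refl)
odd-prime>2 {q = suc q} p-prime refl = s≤s (*-monoʳ-≤ 2 (s≤s z≤n))

2^[1+r]*3+1≡1+2q : ∀ r → 2 ^ suc r * 3 + 1 ≡ 1 + 2 * (2 ^ r * 3)
2^[1+r]*3+1≡1+2q r = rearrange (2 ^ r)
  where
  rearrange : ∀ x → 2 * x * 3 + 1 ≡ 1 + 2 * (x * 3)
  rearrange = solve-∀

lemma5p9 : (c r a b z Y Z N e : ℕ) →
    Prime c → 1 ≤ r → c ≡ 2 ^ r * 3 + 1 →
    1 < a → 1 < b →
    Coprime a b → Coprime a c → Coprime b c →
    IsEOrd c a 3 → IsEOrd c b 3 →
    1 ≤ z → 1 ≤ Y → 1 ≤ Z → z ≤ Z →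
    Y % 6 ≡ 4 →
    a + b ≡ c ^ z → a + b ^ Y ≡ c ^ Z →
    Y ≡ 1 + 3 * N → IsVal c N e →
    e < z × ∃ λ K → 1 ≤ K × Coprime K c ×
    (b ^ 2 + b + 1 ≡ K * c ^ (z ∸ e)) ×
    (b * (b ∸ 1) * I b N * K ≡ c ^ e * (c ^ (Z ∸ z) ∸ 1))
lemma5p9 c (suc r) a (suc β) (suc z) Y Z N e c-prime (s≤s z≤n) c≡2^r*3+1 _ (s≤s _) _ _ b⊥c _ eo (s≤s z≤n) _ _ z≤Z
         Y%6≡4 a+b≡c^z a+b^Y≡c^Z refl νN with [1+3n]%6≡4⇒odd N Y%6≡4
... | k , refl =
  let e<z , K , c∤K , V≡K*c^[z∸e] , bβIK≡ =
        split-cofactor {m = b * β} {x = I b N} {k = Z ∸ suc z} c-prime V>0 c∣V c∤bβ νI bβVI≡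
  in e<z , K , ¬∣⇒>0 c∤K , ¬∣⇒coprime c-prime c∤K , V≡K*c^[z∸e] , bβIK≡
  where
  b = suc β
  V = b ^ 2 + b + 1
  V>0 : 0 < V
  V>0 = m≤n+m 1 (b ^ 2 + b)
  q = 2 ^ r * 3
  c≡1+2q : c ≡ 1 + 2 * q
  c≡1+2q = trans c≡2^r*3+1 (2^[1+r]*3+1≡1+2q r)
  c∤b : ¬ c ∣ b
  c∤b c∣b = <⇒≢ (prime⇒>1 c-prime) (sym (b⊥c (c∣b , ∣-refl)))
  c∤bβ : ¬ c ∣ b * β
  c∤bβ c∣bβ = [ c∤b , isEOrd>1⇒∤pred eo (s≤s (s≤s z≤n)) ]′ (euclidsLemma b β c-prime c∣bβ)
  bβVI≡ : b * β * V * I b N ≡ c ^ suc z * (c ^ (Z ∸ suc z) ∸ 1)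
  bβVI≡ = x≡c^z*[c^[Z∸z]∸1] {a} {b} z≤Z a+b≡c^z
            (subst (λ y → a + y ≡ c ^ Z) ([1+β]^[1+3n]≡[1+β]+[1+β]βVI β N) a+b^Y≡c^Z)
  c∣V : c ∣ V
  c∣V = isEOrd≡3⇒∣b²+b+1 {k = k} c-prime (odd-prime>2 {q = q} c-prime c≡1+2q) eo c∤b
          (subst (c ∣_) (sym bβVI≡) (∣m⇒∣m*n (c ^ (Z ∸ suc z) ∸ 1) (m∣m*n (c ^ z))))
  νI : IsVal c (I b N) e
  νI = isVal-I {q = q} {β} {e = e} c-prime c≡1+2q c∣V νN
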